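{- Let $G$ be a finite simple undirected graph, let $\mathcal{P}$ be a minimum-weight clique partition of $G$, and let $\mathcal{C}$ be the set of maximal cliques of $G$. Then there exists at least one mapping $f:\mathcal{P}\to\mathcal{C}$ with $P\subseteq f(P)$ for every $P\in\mathcal{P}$, and every such mapping is injective.
   Context: A clique partition of $G$ is a partition of $V(G)$ into sets each of which is a clique in $G$. The weight of a clique partition $\{P_1,\dots,P_k\}$ is $\prod_{i=1}^{k}(|P_i|+1)$. -}

module Defs where

open import Data.Nat using (ℕ; suc; _*_; _≤_)
open import Data.Bool using (Bool; true; false)
open import Data.Fin using (Fin)
open import Data.Fin.Subset using (Subset; _∈_; _⊆_; ∣_∣; Nonempty)
open import Data.List using (List; length; lookup; map)
open import Data.Nat.ListAction using (product)
open import Data.Product using (∃; _×_)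
open import Relation.Binary.PropositionalEquality using (_≡_; _≢_)

record Graph (n : ℕ) : Set where
  field
    adj   : Fin n → Fin n → Bool
    sym   : ∀ u v → adj u v ≡ adj v u
    irrefl : ∀ v → adj v v ≡ false

open Graph public

Adj : ∀ {n} → Graph n → Fin n → Fin n → Set
Adj G u v = adj G u v ≡ true

IsClique : ∀ {n} → Graph n → Subset n → Set
IsClique G S = ∀ u v → u ∈ S → v ∈ S → u ≢ v → Adj G u v

IsMaximalClique : ∀ {n} → Graph n → Subset n → Set
IsMaximalClique G S = IsClique G S × (∀ T → IsClique G T → S ⊆ T → T ⊆ S)

IsCliquePartition : ∀ {n} → Graph n → List (Subset n) → Set
IsCliquePartition {n} G P =
  (∀ i → Nonempty (lookup P i)) ×
  (∀ i → IsClique G (lookup P i)) ×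
  (∀ i j (x : Fin n) → x ∈ lookup P i → x ∈ lookup P j → i ≡ j) ×
  (∀ (x : Fin n) → ∃ λ i → x ∈ lookup P i)

weight : ∀ {n} → List (Subset n) → ℕ
weight P = product (map (λ B → suc ∣ B ∣) P)

IsMinWeightCliquePartition : ∀ {n} → Graph n → List (Subset n) → Set
IsMinWeightCliquePartition G P =
  IsCliquePartition G P × (∀ Q → IsCliquePartition G Q → weight P ≤ weight Q)

-- In a minimum-weight clique partition no two blocks lie in a common clique:
-- replacing blocks A and B by the single clique A ∪ B changes the weight by the factor
-- (|A ∪ B| + 1) / ((|A| + 1)(|B| + 1)) < 1, since |A ∪ B| ≤ |A| + |B| and A, B are nonempty.
-- Hence two blocks cannot be sent to the same maximal clique. Existence of the map is the
-- fact that every clique extends, greedily, to a maximal one.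
module Submission where

open import Defs hiding (sym)
open import Data.Nat using (ℕ; suc; z<s; _+_; _*_; _≤_; _<_; _>_; s≤s; z≤n; NonZero)
open import Data.Nat.Properties
  using ( *-commutativeSemigroup; *-assoc; *-monoˡ-<; +-suc; m<m+n; m*n≢0
        ; ≤-reflexive; ≤-trans; ≤-<-trans; n≤1+n; <⇒≱; module ≤-Reasoning )
open import Data.Nat.Tactic.RingSolver using (solve-∀)
open import Algebra.Properties.CommutativeSemigroup *-commutativeSemigroup using (x∙yz≈y∙xz)
open import Data.Nat.ListAction using (product)
open import Data.Bool using (true; false)
open import Data.Bool.Properties using () renaming (_≟_ to _≟ᴮ_)
open import Data.Fin using (Fin; zero; suc; _≟_)
open import Data.Fin.Properties using (all?; suc-injective)
open import Data.Fin.Subset using (Subset; _⊆_; _∈_; _∪_; ⁅_⁆; ∣_∣; Nonempty)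
open import Data.Fin.Subset.Properties using (x∈⁅x⁆; x∈⁅y⁆⇒x≡y; p⊆p∪q; x∈p∪q⁻; x∈p∪q⁺; _∈?_)
open import Data.Vec as Vec using (_∷_; [])
open import Data.List using (List; []; _∷_; length; lookup; map; foldl; allFin; removeAt)
open import Data.List.Relation.Unary.Any using (here; there)
import Data.List.Membership.Propositional as List
open import Data.List.Membership.Propositional.Properties using (∈-allFin)
open import Data.Product using (Σ; ∃; _×_; _,_; proj₁; proj₂)
open import Data.Sum using (_⊎_; inj₁; inj₂; [_,_])
open import Data.Empty using (⊥; ⊥-elim)
open import Relation.Nullary using (Dec; yes; no; ¬?; contradiction)
open import Relation.Nullary.Decidable using (_→-dec_)
open import Function using (_∘_)
open import Relation.Binary.PropositionalEquality
  using (_≡_; _≢_; refl; sym; trans; cong; subst; module ≡-Reasoning)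

module _ {n : ℕ} (G : Graph n) where

  isClique-⊆ : ∀ {S T} → IsClique G T → S ⊆ T → IsClique G S
  isClique-⊆ cT S⊆T u v u∈S v∈S = cT u v (S⊆T u∈S) (S⊆T v∈S)

  CanJoin : Subset n → Fin n → Set
  CanJoin S v = ∀ u → u ∈ S → u ≢ v → Adj G u v

  canJoin? : ∀ S v → Dec (CanJoin S v)
  canJoin? S v = all? λ u → (u ∈? S) →-dec (¬? (u ≟ v) →-dec (adj G u v ≟ᴮ true))

  tryJoin : Subset n → Fin n → Subset n
  tryJoin S v with canJoin? S v
  ... | yes _ = S ∪ ⁅ v ⁆
  ... | no _  = S

  ⊆-tryJoin : ∀ S v → S ⊆ tryJoin S v
  ⊆-tryJoin S v with canJoin? S v
  ... | yes _ = p⊆p∪q ⁅ v ⁆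
  ... | no _  = λ x∈S → x∈S

  ∈-tryJoin : ∀ S v → CanJoin S v → v ∈ tryJoin S v
  ∈-tryJoin S v canJoin with canJoin? S v
  ... | yes _ = x∈p∪q⁺ (inj₂ (x∈⁅x⁆ v))
  ... | no ¬canJoin = contradiction canJoin ¬canJoin

  tryJoin-isClique : ∀ S v → IsClique G S → IsClique G (tryJoin S v)
  tryJoin-isClique S v cS with canJoin? S v
  ... | no _ = cS
  ... | yes canJoin = λ u w u∈ w∈ → adjacent u w (x∈p∪q⁻ S ⁅ v ⁆ u∈) (x∈p∪q⁻ S ⁅ v ⁆ w∈)
    where
    adjacent : ∀ u w → u ∈ S ⊎ u ∈ ⁅ v ⁆ → w ∈ S ⊎ w ∈ ⁅ v ⁆ → u ≢ w → Adj G u w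
    adjacent u w (inj₁ u∈S) (inj₁ w∈S) u≢w = cS u w u∈S w∈S u≢w
    adjacent u w (inj₁ u∈S) (inj₂ w∈v) u≢w with x∈⁅y⁆⇒x≡y v w∈v
    ... | refl = canJoin u u∈S u≢w
    adjacent u w (inj₂ u∈v) (inj₁ w∈S) u≢w with x∈⁅y⁆⇒x≡y v u∈v
    ... | refl = trans (Graph.sym G u w) (canJoin w w∈S (λ w≡u → u≢w (sym w≡u)))
    adjacent u w (inj₂ u∈v) (inj₂ w∈v) u≢w =
      contradiction (trans (x∈⁅y⁆⇒x≡y v u∈v) (sym (x∈⁅y⁆⇒x≡y v w∈v))) u≢w

  ⊆-tryJoinAll : ∀ S vs → S ⊆ foldl tryJoin S vs
  ⊆-tryJoinAll S []       x∈S = x∈S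
  ⊆-tryJoinAll S (v ∷ vs) x∈S = ⊆-tryJoinAll (tryJoin S v) vs (⊆-tryJoin S v x∈S)

  tryJoinAll-isClique : ∀ S vs → IsClique G S → IsClique G (foldl tryJoin S vs)
  tryJoinAll-isClique S []       cS = cS
  tryJoinAll-isClique S (v ∷ vs) cS = tryJoinAll-isClique (tryJoin S v) vs (tryJoin-isClique S v cS)

  -- Cliques only grow along the fold, so a vertex joinable at the end was joinable when tried.
  tryJoinAll-saturated : ∀ S vs T → IsClique G T → foldl tryJoin S vs ⊆ T →
                         ∀ {v} → v List.∈ vs → v ∈ T → v ∈ foldl tryJoin S vs
  tryJoinAll-saturated S (w ∷ vs) T cT ⊆T (there v∈vs) v∈T =
    tryJoinAll-saturated (tryJoin S w) vs T cT ⊆T v∈vs v∈T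
  tryJoinAll-saturated S (v ∷ vs) T cT ⊆T (here refl) v∈T =
    ⊆-tryJoinAll (tryJoin S v) vs (∈-tryJoin S v λ u u∈S u≢v →
      cT u v (⊆T (⊆-tryJoinAll (tryJoin S v) vs (⊆-tryJoin S v u∈S))) v∈T u≢v)

  extendToMaximalClique : ∀ S → IsClique G S → ∃ λ T → IsMaximalClique G T × S ⊆ T
  extendToMaximalClique S cS =
    foldl tryJoin S (allFin n)
    , (tryJoinAll-isClique S (allFin n) cS
      , λ T cT ⊆T v∈T → tryJoinAll-saturated S (allFin n) T cT ⊆T (∈-allFin _) v∈T)
    , ⊆-tryJoinAll S (allFin n)

module _ {A : Set} where

  embedRemoveAt : (xs : List A) (j : Fin (length xs)) → Fin (length (removeAt xs j)) → Fin (length xs)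
  embedRemoveAt (x ∷ xs) zero    k       = suc k
  embedRemoveAt (x ∷ xs) (suc j) zero    = zero
  embedRemoveAt (x ∷ xs) (suc j) (suc k) = suc (embedRemoveAt xs j k)

  lookup-removeAt : ∀ (xs : List A) j k → lookup (removeAt xs j) k ≡ lookup xs (embedRemoveAt xs j k)
  lookup-removeAt (x ∷ xs) zero    k       = refl
  lookup-removeAt (x ∷ xs) (suc j) zero    = refl
  lookup-removeAt (x ∷ xs) (suc j) (suc k) = lookup-removeAt xs j k

  embedRemoveAt≢ : ∀ (xs : List A) j k → embedRemoveAt xs j k ≢ j
  embedRemoveAt≢ (x ∷ xs) zero    k       ()
  embedRemoveAt≢ (x ∷ xs) (suc j) zero    ()
  embedRemoveAt≢ (x ∷ xs) (suc j) (suc k) eq = embedRemoveAt≢ xs j k (suc-injective eq)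

  embedRemoveAt-injective : ∀ (xs : List A) j k l → embedRemoveAt xs j k ≡ embedRemoveAt xs j l → k ≡ l
  embedRemoveAt-injective (x ∷ xs) zero    k       l       refl = refl
  embedRemoveAt-injective (x ∷ xs) (suc j) zero    zero    eq   = refl
  embedRemoveAt-injective (x ∷ xs) (suc j) (suc k) (suc l) eq   =
    cong suc (embedRemoveAt-injective xs j k l (suc-injective eq))

  embedRemoveAt-surjective : ∀ (xs : List A) j m → m ≢ j → ∃ λ k → embedRemoveAt xs j k ≡ m
  embedRemoveAt-surjective (x ∷ xs) zero    zero    m≢j = contradiction refl m≢j
  embedRemoveAt-surjective (x ∷ xs) zero    (suc m) m≢j = m , refl
  embedRemoveAt-surjective (x ∷ xs) (suc j) zero    m≢j = zero , refl
  embedRemoveAt-surjective (x ∷ xs) (suc j) (suc m) m≢j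
    with embedRemoveAt-surjective xs j m (λ m≡j → m≢j (cong suc m≡j))
  ... | k , eq = suc k , cong suc eq

  product-removeAt : ∀ (g : A → ℕ) (xs : List A) j →
                     product (map g xs) ≡ g (lookup xs j) * product (map g (removeAt xs j))
  product-removeAt g (x ∷ xs) zero    = refl
  product-removeAt g (x ∷ xs) (suc j) = begin
    g x * product (map g xs)                                    ≡⟨ cong (g x *_) (product-removeAt g xs j) ⟩
    g x * (g (lookup xs j) * product (map g (removeAt xs j)))   ≡⟨ x∙yz≈y∙xz (g x) (g (lookup xs j)) _ ⟩
    g (lookup xs j) * (g x * product (map g (removeAt xs j)))   ∎
    where open ≡-Reasoning

record Without {A : Set} (xs : List A) (i j : Fin (length xs)) : Set where
  field
    rest             : List A
    embed            : Fin (length rest) → Fin (length xs)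
    lookup-rest      : ∀ k → lookup rest k ≡ lookup xs (embed k)
    embed-injective  : ∀ k l → embed k ≡ embed l → k ≡ l
    embed≢i          : ∀ k → embed k ≢ i
    embed≢j          : ∀ k → embed k ≢ j
    embed-surjective : ∀ m → m ≢ i → m ≢ j → ∃ λ k → embed k ≡ m
    product-rest     : ∀ (g : A → ℕ) →
                       product (map g xs) ≡ g (lookup xs i) * (g (lookup xs j) * product (map g rest))

without : ∀ {A : Set} (xs : List A) {i j} → i ≢ j → Without xs i j
without {A} xs {i} {j} i≢j = record
  { rest             = zs
  ; embed            = embed
  ; lookup-rest      = λ k → trans (lookup-removeAt ys i′ k) (lookup-removeAt xs j _)
  ; embed-injective  = λ k l eq →
      embedRemoveAt-injective ys i′ k l (embedRemoveAt-injective xs j _ _ eq)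
  ; embed≢i          = λ k eq →
      embedRemoveAt≢ ys i′ k (embedRemoveAt-injective xs j _ _ (trans eq (sym i′↦i)))
  ; embed≢j          = λ k → embedRemoveAt≢ xs j _
  ; embed-surjective = surjective
  ; product-rest     = product-rest
  }
  where
  ys : List A
  ys = removeAt xs j

  i′ : Fin (length ys)
  i′ = proj₁ (embedRemoveAt-surjective xs j i i≢j)

  i′↦i : embedRemoveAt xs j i′ ≡ i
  i′↦i = proj₂ (embedRemoveAt-surjective xs j i i≢j)

  zs : List A
  zs = removeAt ys i′

  embed : Fin (length zs) → Fin (length xs)
  embed k = embedRemoveAt xs j (embedRemoveAt ys i′ k)

  surjective : ∀ m → m ≢ i → m ≢ j → ∃ λ k → embed k ≡ m
  surjective m m≢i m≢j with embedRemoveAt-surjective xs j m m≢j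
  ... | m′ , m′↦m with embedRemoveAt-surjective ys i′ m′
                         (λ m′≡i′ → m≢i (trans (sym m′↦m) (trans (cong (embedRemoveAt xs j) m′≡i′) i′↦i)))
  ... | k , k↦m′ = k , trans (cong (embedRemoveAt xs j) k↦m′) m′↦m

  product-rest : ∀ g → product (map g xs) ≡ g (lookup xs i) * (g (lookup xs j) * product (map g zs))
  product-rest g = begin
    product (map g xs)                             ≡⟨ product-removeAt g xs j ⟩
    g xⱼ * product (map g ys)                      ≡⟨ cong (g xⱼ *_) (product-removeAt g ys i′) ⟩
    g xⱼ * (g (lookup ys i′) * product (map g zs)) ≡⟨ cong (λ B → g xⱼ * (g B * product (map g zs))) ys[i′]≡xᵢ ⟩
    g xⱼ * (g xᵢ * product (map g zs))             ≡⟨ x∙yz≈y∙xz (g xⱼ) (g xᵢ) (product (map g zs)) ⟩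
    g xᵢ * (g xⱼ * product (map g zs))             ∎
    where
    open ≡-Reasoning
    xᵢ xⱼ : A
    xᵢ = lookup xs i
    xⱼ = lookup xs j
    ys[i′]≡xᵢ : lookup ys i′ ≡ xᵢ
    ys[i′]≡xᵢ = trans (lookup-removeAt xs j i′) (cong (lookup xs) i′↦i)

∪-⊆ : ∀ {n} {p q r : Subset n} → p ⊆ r → q ⊆ r → p ∪ q ⊆ r
∪-⊆ {p = p} {q} p⊆r q⊆r x∈p∪q = [ p⊆r , q⊆r ] (x∈p∪q⁻ p q x∈p∪q)

∣p∪q∣≤∣p∣+∣q∣ : ∀ {n} (p q : Subset n) → ∣ p ∪ q ∣ ≤ ∣ p ∣ + ∣ q ∣
∣p∪q∣≤∣p∣+∣q∣ []            []            = z≤n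
∣p∪q∣≤∣p∣+∣q∣ (true ∷ p)    (true ∷ q)    =
  s≤s (≤-trans (∣p∪q∣≤∣p∣+∣q∣ p q) (≤-trans (n≤1+n _) (≤-reflexive (sym (+-suc ∣ p ∣ ∣ q ∣)))))
∣p∪q∣≤∣p∣+∣q∣ (true ∷ p)    (false ∷ q)   = s≤s (∣p∪q∣≤∣p∣+∣q∣ p q)
∣p∪q∣≤∣p∣+∣q∣ (false ∷ p)   (true ∷ q)    =
  ≤-trans (s≤s (∣p∪q∣≤∣p∣+∣q∣ p q)) (≤-reflexive (sym (+-suc ∣ p ∣ ∣ q ∣)))
∣p∪q∣≤∣p∣+∣q∣ (false ∷ p)   (false ∷ q)   = ∣p∪q∣≤∣p∣+∣q∣ p q

nonempty⇒∣p∣>0 : ∀ {n} (p : Subset n) → Nonempty p → ∣ p ∣ > 0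
nonempty⇒∣p∣>0 (true ∷ p)  _                         = z<s
nonempty⇒∣p∣>0 (false ∷ p) (suc x , Vec.there x∈p) = nonempty⇒∣p∣>0 p (x , x∈p)

1+m+n<[1+m]*[1+n] : ∀ m n → m > 0 → n > 0 → suc (m + n) < suc m * suc n
1+m+n<[1+m]*[1+n] (suc m) (suc n) _ _ =
  subst (suc (suc m + suc n) <_) (sym (expand (suc m) (suc n))) (m<m+n _ z<s)
  where
  expand : ∀ a b → suc a * suc b ≡ suc (a + b) + a * b
  expand = solve-∀

weight-nonZero : ∀ {n} (Bs : List (Subset n)) → NonZero (weight Bs)
weight-nonZero []       = _
weight-nonZero (B ∷ Bs) = m*n≢0 (suc ∣ B ∣) (weight Bs) {{_}} {{weight-nonZero Bs}}

module Merge {n} (G : Graph n) (P : List (Subset n)) (part : IsCliquePartition G P)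
             {i j : Fin (length P)} (i≢j : i ≢ j) where

  open Without (without P i≢j)

  private
    nonempty : ∀ k → Nonempty (lookup P k)
    nonempty = proj₁ part
    clique : ∀ k → IsClique G (lookup P k)
    clique = proj₁ (proj₂ part)
    disjoint : ∀ a b (x : Fin n) → x ∈ lookup P a → x ∈ lookup P b → a ≡ b
    disjoint = proj₁ (proj₂ (proj₂ part))
    covers : ∀ (x : Fin n) → ∃ λ a → x ∈ lookup P a
    covers = proj₂ (proj₂ (proj₂ part))

  U : Subset n
  U = lookup P i ∪ lookup P j

  merged : List (Subset n)
  merged = U ∷ rest

  ∈-rest⇒∈-embed : ∀ {x} k → x ∈ lookup rest k → x ∈ lookup P (embed k)
  ∈-rest⇒∈-embed {x} k = subst (x ∈_) (lookup-rest k)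

  merged-isCliquePartition : IsClique G U → IsCliquePartition G merged
  merged-isCliquePartition cU = nonempty′ , clique′ , disjoint′ , covers′
    where
    nonempty′ : ∀ k → Nonempty (lookup merged k)
    nonempty′ zero    = let x , x∈ = nonempty i in x , p⊆p∪q (lookup P j) x∈
    nonempty′ (suc k) = let x , x∈ = nonempty (embed k) in x , subst (x ∈_) (sym (lookup-rest k)) x∈

    clique′ : ∀ k → IsClique G (lookup merged k)
    clique′ zero    = cU
    clique′ (suc k) = subst (IsClique G) (sym (lookup-rest k)) (clique (embed k))

    U-disjoint-rest : ∀ x k → x ∈ U → x ∈ lookup rest k → ⊥
    U-disjoint-rest x k x∈U x∈k with x∈p∪q⁻ (lookup P i) (lookup P j) x∈U
    ... | inj₁ x∈i = embed≢i k (disjoint (embed k) i x (∈-rest⇒∈-embed k x∈k) x∈i)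
    ... | inj₂ x∈j = embed≢j k (disjoint (embed k) j x (∈-rest⇒∈-embed k x∈k) x∈j)

    disjoint′ : ∀ a b (x : Fin n) → x ∈ lookup merged a → x ∈ lookup merged b → a ≡ b
    disjoint′ zero    zero    x _   _   = refl
    disjoint′ zero    (suc l) x x∈a x∈b = ⊥-elim (U-disjoint-rest x l x∈a x∈b)
    disjoint′ (suc k) zero    x x∈a x∈b = ⊥-elim (U-disjoint-rest x k x∈b x∈a)
    disjoint′ (suc k) (suc l) x x∈a x∈b =
      cong suc (embed-injective k l (disjoint _ _ x (∈-rest⇒∈-embed k x∈a) (∈-rest⇒∈-embed l x∈b)))

    covers′ : ∀ (x : Fin n) → ∃ λ a → x ∈ lookup merged a
    covers′ x with covers x
    ... | m , x∈m with m ≟ i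
    ... | yes refl = zero , p⊆p∪q (lookup P j) x∈m
    ... | no m≢i with m ≟ j
    ... | yes refl = zero , x∈p∪q⁺ (inj₂ x∈m)
    ... | no m≢j with embed-surjective m m≢i m≢j
    ... | k , k↦m = suc k , subst (x ∈_) (sym (trans (lookup-rest k) (cong (lookup P) k↦m))) x∈m

  weight-merged : weight merged < weight P
  weight-merged = begin-strict
    suc ∣ U ∣ * W               <⟨ *-monoˡ-< W {{weight-nonZero rest}} |U|<ab ⟩
    (suc a * suc b) * W         ≡⟨ *-assoc (suc a) (suc b) W ⟩
    suc a * (suc b * W)         ≡⟨ sym (product-rest (λ B → suc ∣ B ∣)) ⟩
    weight P                    ∎
    where
    open ≤-Reasoning
    a b W : ℕ
    a = ∣ lookup P i ∣
    b = ∣ lookup P j ∣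
    W = weight rest
    |U|<ab : suc ∣ U ∣ < suc a * suc b
    |U|<ab = ≤-<-trans (s≤s (∣p∪q∣≤∣p∣+∣q∣ (lookup P i) (lookup P j)))
               (1+m+n<[1+m]*[1+n] a b (nonempty⇒∣p∣>0 _ (nonempty i)) (nonempty⇒∣p∣>0 _ (nonempty j)))

lemma8 : ∀ {n} (G : Graph n) (P : List (Subset n)) →
    IsMinWeightCliquePartition G P →
    (Σ (Fin (length P) → Subset n) λ f →
        ∀ i → IsMaximalClique G (f i) × lookup P i ⊆ f i)
    × (∀ (f : Fin (length P) → Subset n) →
        (∀ i → IsMaximalClique G (f i) × lookup P i ⊆ f i) →
        ∀ i j → f i ≡ f j → i ≡ j)
lemma8 G P (part , minimal) = (proj₁ ∘ maximalCover , proj₂ ∘ maximalCover) , injective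
  where
  maximalCover : ∀ i → ∃ λ C → IsMaximalClique G C × lookup P i ⊆ C
  maximalCover i = extendToMaximalClique G (lookup P i) (proj₁ (proj₂ part) i)

  injective : ∀ f → (∀ i → IsMaximalClique G (f i) × lookup P i ⊆ f i) → ∀ i j → f i ≡ f j → i ≡ j
  injective f maximal⊇ i j fi≡fj with i ≟ j
  ... | yes i≡j = i≡j
  ... | no i≢j  = contradiction (minimal merged (merged-isCliquePartition U-isClique)) (<⇒≱ weight-merged)
    where
    open Merge G P part i≢j
    U⊆fi : U ⊆ f i
    U⊆fi = ∪-⊆ (proj₂ (maximal⊇ i)) (subst (lookup P j ⊆_) (sym fi≡fj) (proj₂ (maximal⊇ j)))
    U-isClique : IsClique G U
    U-isClique = isClique-⊆ G (proj₁ (proj₁ (maximal⊇ i))) U⊆fi
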